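{- Assume $\mathbb T$ is propositionally stable and that the axiom (SQCI) holds, i.e. $\mathbb I$ is stably quasi-coherent. Then $\mathbb I$ is conservative: for all $i,j:\mathbb I$, \[ \big((i=1)\leftrightarrow(j=1)\big)\leftrightarrow (i=j). \]
   Context: We work in intensional type theory with function extensionality (univalent conventions: a proposition is a $(-1)$-type, a set a $0$-type; $\exists$ and $\vee$ denote propositionally truncated $\Sigma$ and $+$). We are given a model $\mathbb I$ (a set with operations) of a Horn theory $\mathbb T$. An $\mathbb I$-algebra is a $\mathbb T$-model $A$ together with a homomorphism $\mathbb I\to A$; elements of $\mathbb I$ are identified with their images in $A$. $\mathbb I\text{ - }\mathbf{Alg}(A,B)$ denotes the set of $\mathbb I$-algebra homomorphisms. The spectrum is $\operatorname{Spec}A:=\mathbb I\text{ - }\mathbf{Alg}(A,\mathbb I)$, and for a set $X$ the observation algebra is $\mathcal O X:=\mathbb I^X=\prod_{x:X}\mathbb I$ (pointwise structure). $A$ is quasi-coherent if the map $\iota_A:A\to\mathcal O\operatorname{Spec}A$, $a\mapsto(x\mapsto x(a))$, is an isomorphism of $\mathbb I$-algebras. For lists $a,b:n\to A$, $A/(a=b)$ is the quotient algebra identifying $a_k$ with $b_k$. $A$ is stably quasi-coherent if for every $n:\mathbb N$ and all $a,b:n\to A$ the quotient $A/(a=b)$ is quasi-coherent. Axiom (SQCI): $\mathbb I$ is stably quasi-coherent. $\mathbb T$ is propositionally stable if it extends the theory of bounded meet-semilattices $(1,\wedge)$ and for every $\mathbb T$-model $A$ and $a:A$, the quotient $A/(a=1)$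 is given by the map $a\wedge-:A\to{\downarrow}a=\{b:A\mid b\le a\}$ (with $\le$ the meet-semilattice order). -}

module Defs where

open import Data.Nat using (ℕ; zero; suc)
open import Data.Fin using (Fin; zero; suc)
open import Data.List using (List)
open import Data.List.Relation.Unary.All using (All)
open import Data.Product using (Σ; _×_; _,_; proj₁; proj₂; Σ-syntax)
open import Relation.Binary.PropositionalEquality using (_≡_; refl; trans; cong)
open import Function using (_∘_; id)

IsSet : Set → Set
IsSet A = {x y : A} (p q : x ≡ y) → p ≡ q

data Term (Op : Set) (ar : Op → ℕ) (m : ℕ) : Set where
  var : Fin m → Term Op ar m
  app : (o : Op) → (Fin (ar o) → Term Op ar m) → Term Op ar m

record HornClause (Op : Set) (ar : Op → ℕ) : Set where
  field
    vars       : ℕ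
    premises   : List (Term Op ar vars × Term Op ar vars)
    conclusion : Term Op ar vars × Term Op ar vars

record Theory : Set₁ where
  field
    Op    : Set
    ar    : Op → ℕ
    Ax    : Set
    axiom : Ax → HornClause Op ar

module _ (T : Theory) where
  open Theory T

  Interp : Set → Set
  Interp A = (o : Op) → (Fin (ar o) → A) → A

  eval : {A : Set} {m : ℕ} → Interp A → Term Op ar m → (Fin m → A) → A
  eval I (var k)    ρ = ρ k
  eval I (app o ts) ρ = I o (λ k → eval I (ts k) ρ)

  HoldsEq : {A : Set} {m : ℕ} → Interp A → (Fin m → A) → Term Op ar m × Term Op ar m → Set
  HoldsEq I ρ (s , t) = eval I s ρ ≡ eval I t ρ

  record Structure (A : Set) : Set where
    field
      isSet : IsSet A
      op    : Interp A
      sat   : (ax : Ax) (ρ : Fin (HornClause.vars (axiom ax)) → A) →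
              All (HoldsEq op ρ) (HornClause.premises (axiom ax)) →
              HoldsEq op ρ (HornClause.conclusion (axiom ax))

  record Model : Set₁ where
    constructor model
    field
      carrier : Set
      str     : Structure carrier
    open Structure str public

  open Model public using (carrier)

  record Hom (A B : Model) : Set where
    field
      fun : Model.carrier A → Model.carrier B
      pres : (o : Op) (xs : Fin (ar o) → Model.carrier A) →
             fun (Model.op A o xs) ≡ Model.op B o (fun ∘ xs)
  open Hom public

  idHom : (A : Model) → Hom A A
  idHom A = record { fun = id ; pres = λ o xs → refl }

  _∘H_ : {A B C : Model} → Hom B C → Hom A B → Hom A C
  _∘H_ {A} {B} {C} g f = record
    { fun  = fun g ∘ fun f
    ; pres = λ o xs → trans (cong (fun g) (pres f o xs)) (pres g o (fun f ∘ xs)) }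

  record IsQuotient {A Q : Model} (q : Hom A Q) {n : ℕ}
                    (a b : Fin n → carrier A) : Set₁ where
    field
      resp   : (k : Fin n) → fun q (a k) ≡ fun q (b k)
      factor : (C : Model) (f : Hom A C) → ((k : Fin n) → fun f (a k) ≡ fun f (b k)) →
               Σ[ g ∈ Hom Q C ] ((x : carrier A) → fun g (fun q x) ≡ fun f x)
      unique : (C : Model) (g h : Hom Q C) →
               ((x : carrier A) → fun g (fun q x) ≡ fun h (fun q x)) →
               (y : carrier Q) → fun g y ≡ fun h y

  module _ (𝕀 : Model) where

    record IAlg : Set₁ where
      constructor ialg
      field
        mdl  : Model
        unit : Hom 𝕀 mdl
    open IAlg public

    record IHom (A B : IAlg) : Set where
      field
        hom : Hom (mdl A) (mdl B)
        comm : (i : carrier 𝕀) → fun hom (fun (unit A) i) ≡ fun (unit B) i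
    open IHom public

    𝕀alg : IAlg
    𝕀alg = ialg 𝕀 (idHom 𝕀)

    Spec : IAlg → Set
    Spec A = IHom A 𝕀alg

    -- 𝒪 X = 𝕀^X (as a set; its algebra structure is pointwise)
    𝒪 : Set → Set
    𝒪 X = X → carrier 𝕀

    ι : (A : IAlg) → carrier (mdl A) → 𝒪 (Spec A)
    ι A a x = fun (hom x) a

    -- ι_A (always a homomorphism of 𝕀-algebras into the pointwise
    -- algebra 𝒪 (Spec A)) is an isomorphism, i.e. has a two-sided inverse.
    QuasiCoherent : IAlg → Set
    QuasiCoherent A =
      Σ[ g ∈ (𝒪 (Spec A) → carrier (mdl A)) ]
        (((a : carrier (mdl A)) → g (ι A a) ≡ a) ×
         ((φ : 𝒪 (Spec A)) → ι A (g φ) ≡ φ))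

    StablyQuasiCoherent : IAlg → Set₁
    StablyQuasiCoherent A =
      (n : ℕ) (a b : Fin n → carrier (mdl A)) (Q : Model) (q : Hom (mdl A) Q) →
      IsQuotient q a b → QuasiCoherent (ialg Q (q ∘H unit A))

    SQCI : Set₁
    SQCI = StablyQuasiCoherent 𝕀alg

  vec2 : {A : Set} → A → A → Fin 2 → A
  vec2 x y zero    = x
  vec2 x y (suc _) = y

  vec0 : {A : Set} → Fin 0 → A
  vec0 ()

  record MeetSemilatticeExt : Set₁ where
    field
      one  : Term Op ar 0
      meet : Term Op ar 2
    1ᴹ : (A : Model) → carrier A
    1ᴹ A = eval (Model.op A) one vec0
    ∧ᴹ : (A : Model) → carrier A → carrier A → carrier A
    ∧ᴹ A x y = eval (Model.op A) meet (vec2 x y)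
    field
      ∧-assoc : (A : Model) (x y z : carrier A) → ∧ᴹ A (∧ᴹ A x y) z ≡ ∧ᴹ A x (∧ᴹ A y z)
      ∧-comm  : (A : Model) (x y : carrier A) → ∧ᴹ A x y ≡ ∧ᴹ A y x
      ∧-idem  : (A : Model) (x : carrier A) → ∧ᴹ A x x ≡ x
      ∧-unit  : (A : Model) (x : carrier A) → ∧ᴹ A x (1ᴹ A) ≡ x

    ↓ : (A : Model) → carrier A → Set
    ↓ A a = Σ[ b ∈ carrier A ] (∧ᴹ A b a ≡ b)

    PropositionallyStable : Set₁
    PropositionallyStable =
      (A : Model) (a : carrier A) →
      Σ[ S ∈ Structure (↓ A a) ]
      Σ[ q ∈ Hom A (model (↓ A a) S) ]
        (((x : carrier A) → proj₁ (fun q x) ≡ ∧ᴹ A a x) ×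
         IsQuotient q {1} (λ _ → a) (λ _ → 1ᴹ A))

module Submission where

-- A point of 𝕀/(a = b), being an 𝕀-algebra map back to 𝕀, fixes every
-- constant, so it can only exist if a = b already holds in 𝕀. Hence, if
-- a = b entails i = j, the images of i and j agree at every point of the
-- quotient, and quasi-coherence (SQCI) makes them equal in the quotient.
-- For a = i, b = 1 propositional stability identifies that quotient with
-- i ∧ - : 𝕀 → ↓i, so (i = 1 → j = 1) gives i ∧ j = i ∧ i = i, i.e. i ≤ j;
-- the converse implication gives j ≤ i.

open import Defs
open import Level using (0ℓ)
open import Relation.Binary.PropositionalEquality
  using (_≡_; refl; sym; trans; cong; module ≡-Reasoning)
open import Function.Base using (id)
open import Function.Bundles using (_⇔_; mk⇔; Equivalence)
open import Axiom.Extensionality.Propositional using (Extensionality)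
open import Data.Nat using (ℕ)
open import Data.Fin using (Fin; zero)
open import Data.Product using (_,_; proj₁; proj₂)

open ≡-Reasoning

module _ (T : Theory) (𝕀 : Model T) where

  ι-injective : Extensionality 0ℓ 0ℓ → (A : IAlg T 𝕀) → QuasiCoherent T 𝕀 A →
    {a b : carrier (mdl A)} → (∀ x → ι T 𝕀 A a x ≡ ι T 𝕀 A b x) → a ≡ b
  ι-injective ext A (g , g∘ι≗id , _) {a} {b} ιa≗ιb = begin
    a               ≡⟨ sym (g∘ι≗id a) ⟩
    g (ι T 𝕀 A a)   ≡⟨ cong g (ext ιa≗ιb) ⟩
    g (ι T 𝕀 A b)   ≡⟨ g∘ι≗id b ⟩
    b               ∎

  module _ {Q : Model T} (q : Hom T 𝕀 Q) where

    quotientAlg : IAlg T 𝕀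
    quotientAlg = ialg Q (_∘H_ T q (idHom T 𝕀))

    point-fixes-constants : (x : Spec T 𝕀 quotientAlg) (i : carrier 𝕀) →
      ι T 𝕀 quotientAlg (fun q i) x ≡ i
    point-fixes-constants x = IHom.comm x

    point-forces-relations : {n : ℕ} {a b : Fin n → carrier 𝕀} → IsQuotient T q a b →
      Spec T 𝕀 quotientAlg → (k : Fin n) → a k ≡ b k
    point-forces-relations {a = a} {b} isQ x k = begin
      a k                                    ≡⟨ sym (point-fixes-constants x (a k)) ⟩
      fun (IHom.hom x) (fun q (a k))         ≡⟨ cong (fun (IHom.hom x)) (IsQuotient.resp isQ k) ⟩
      fun (IHom.hom x) (fun q (b k))         ≡⟨ point-fixes-constants x (b k) ⟩
      b k                                    ∎

    quotient-identifies-entailed : Extensionality 0ℓ 0ℓ → SQCI T 𝕀 →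
      {n : ℕ} {a b : Fin n → carrier 𝕀} → IsQuotient T q a b →
      {i j : carrier 𝕀} → (((k : Fin n) → a k ≡ b k) → i ≡ j) → fun q i ≡ fun q j
    quotient-identifies-entailed ext sqci {n} {a} {b} isQ {i} {j} a≡b⇒i≡j =
      ι-injective ext quotientAlg (sqci n a b Q q isQ) ιi≗ιj
      where
      ιi≗ιj : ∀ x → ι T 𝕀 quotientAlg (fun q i) x ≡ ι T 𝕀 quotientAlg (fun q j) x
      ιi≗ιj x = begin
        ι T 𝕀 quotientAlg (fun q i) x   ≡⟨ point-fixes-constants x i ⟩
        i                               ≡⟨ a≡b⇒i≡j (point-forces-relations isQ x) ⟩
        j                               ≡⟨ sym (point-fixes-constants x j) ⟩
        ι T 𝕀 quotientAlg (fun q j) x   ∎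

module _ {T : Theory} (SL : MeetSemilatticeExt T) where
  open MeetSemilatticeExt SL

  ∧-antisym : (A : Model T) {x y : carrier A} →
    ∧ᴹ A x y ≡ x → ∧ᴹ A y x ≡ y → x ≡ y
  ∧-antisym A {x} {y} x≤y y≤x = begin
    x          ≡⟨ sym x≤y ⟩
    ∧ᴹ A x y   ≡⟨ ∧-comm A x y ⟩
    ∧ᴹ A y x   ≡⟨ y≤x ⟩
    y          ∎

  module _ (stable : PropositionallyStable) where

    ↓quotient : (A : Model T) (a : carrier A) → Hom T A (model (↓ A a) (proj₁ (stable A a)))
    ↓quotient A a = proj₁ (proj₂ (stable A a))

    ↓quotient-is-quotient : (A : Model T) (a : carrier A) →
      IsQuotient T (↓quotient A a) {1} (λ _ → a) (λ _ → 1ᴹ A)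
    ↓quotient-is-quotient A a = proj₂ (proj₂ (proj₂ (stable A a)))

    ↓quotient-reflects : (A : Model T) (a : carrier A) {x y : carrier A} →
      fun (↓quotient A a) x ≡ fun (↓quotient A a) y → ∧ᴹ A a x ≡ ∧ᴹ A a y
    ↓quotient-reflects A a {x} {y} qx≡qy = begin
      ∧ᴹ A a x                        ≡⟨ sym (q≗a∧ x) ⟩
      proj₁ (fun (↓quotient A a) x)   ≡⟨ cong proj₁ qx≡qy ⟩
      proj₁ (fun (↓quotient A a) y)   ≡⟨ q≗a∧ y ⟩
      ∧ᴹ A a y                        ∎
      where
      q≗a∧ : (z : carrier A) → proj₁ (fun (↓quotient A a) z) ≡ ∧ᴹ A a z
      q≗a∧ = proj₁ (proj₂ (proj₂ (stable A a)))

    ≤-of-entailment : Extensionality 0ℓ 0ℓ → (𝕀 : Model T) → SQCI T 𝕀 →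
      {i j : carrier 𝕀} → (i ≡ 1ᴹ 𝕀 → j ≡ 1ᴹ 𝕀) → ∧ᴹ 𝕀 i j ≡ i
    ≤-of-entailment ext 𝕀 sqci {i} {j} i≡1⇒j≡1 = begin
      ∧ᴹ 𝕀 i j   ≡⟨ ↓quotient-reflects 𝕀 i qj≡qi ⟩
      ∧ᴹ 𝕀 i i   ≡⟨ ∧-idem 𝕀 i ⟩
      i          ∎
      where
      qj≡qi : fun (↓quotient 𝕀 i) j ≡ fun (↓quotient 𝕀 i) i
      qj≡qi = quotient-identifies-entailed T 𝕀 (↓quotient 𝕀 i) ext sqci
        (↓quotient-is-quotient 𝕀 i)
        λ i≡1 → trans (i≡1⇒j≡1 (i≡1 zero)) (sym (i≡1 zero))

lemma3p10 : Extensionality 0ℓ 0ℓ →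
    (T : Theory) (SL : MeetSemilatticeExt T) →
    MeetSemilatticeExt.PropositionallyStable {T} SL →
    (𝕀 : Model T) → SQCI T 𝕀 →
    (i j : carrier 𝕀) →
    ((i ≡ MeetSemilatticeExt.1ᴹ {T} SL 𝕀) ⇔ (j ≡ MeetSemilatticeExt.1ᴹ {T} SL 𝕀)) ⇔ (i ≡ j)
lemma3p10 ext T SL stable 𝕀 sqci i j = mk⇔ same-truth⇒≡ ≡⇒same-truth
  where
  open MeetSemilatticeExt SL using (1ᴹ)

  same-truth⇒≡ : (i ≡ 1ᴹ 𝕀) ⇔ (j ≡ 1ᴹ 𝕀) → i ≡ j
  same-truth⇒≡ e = ∧-antisym SL 𝕀
    (≤-of-entailment SL stable ext 𝕀 sqci (Equivalence.to e))
    (≤-of-entailment SL stable ext 𝕀 sqci (Equivalence.from e))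

  ≡⇒same-truth : i ≡ j → (i ≡ 1ᴹ 𝕀) ⇔ (j ≡ 1ᴹ 𝕀)
  ≡⇒same-truth refl = mk⇔ id id
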